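{- Let $P$ be a finite diamond transitive thin poset with unique minimal element $\hat{0}$, let $c$ be a central coloring of $P$, and let $f:P\to\{1,-1\}$ satisfy $f(\hat{0})=1$ and $f(x)f(y)=c(x\lessdot y)$ for every cover relation $x\lessdot y$. Then $f=\mathrm{gr}^c_{\mathcal{O}}$ for every choice $\mathcal{O}$ of linear orderings of the ranks of $P$.
   Context: A graded poset (rank function $\mathrm{rk}$ with $\mathrm{rk}(y)=\mathrm{rk}(x)+1$ for covers, $\mathrm{rk}(\hat0)=0$) is thin if every nonempty closed interval of length 2 has exactly 4 elements (a diamond). Diamond transitive: for all $x\le y$, any two saturated chains from $x$ to $y$ are related by finitely many diamond moves, where for a diamond $\{x,a,b,y\}$ a move replaces a subchain $x\lessdot a\lessdot y$ by $x\lessdot b\lessdot y$ or vice versa. A central coloring is a function $c$ from the set of cover relations to $\{1,-1\}$ whose product over the four edges of every diamond is $+1$. Greedy function $\mathrm{gr}^c_{\mathcal{O}}$, for a fixed linear order $\mathcal{O}$ on each rank: assign $1$ to all rank-0 elements; once all elements of rank $i$ and the first $j$ elements of rank $i+1$ are assigned, the $(j+1)$-st element $u$ of rank $i+1$ gets $1$ if, with this assignment, $\mathrm{gr}(z)\mathrm{gr}(u)=c(z\lessdot u)$ for every already-assigned $z\lessdot u$, and gets $-1$ otherwise. -}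

module Defs where

open import Data.Nat using (ℕ; zero; suc; _+_) renaming (_<_ to _<ℕ_)
open import Data.Fin using (Fin)
open import Data.List using (List; []; _∷_; _++_; length; filter; allFin)
open import Data.List.Membership.Propositional using (_∈_)
open import Data.List.Relation.Unary.Unique.Propositional using (Unique)
open import Data.Product using (Σ; ∃; ∃-syntax; _×_; _,_)
open import Data.Sum using (_⊎_)
open import Data.Empty using (⊥)
open import Data.Sign using (Sign) renaming (_*_ to _*ˢ_)
open import Relation.Nullary using (¬_)
open import Relation.Nullary.Decidable using (_×-dec_)
open import Relation.Binary.Definitions using (Decidable)
open import Relation.Binary.Structures using (IsPartialOrder)
open import Relation.Binary.PropositionalEquality using (_≡_; _≢_)
open import Relation.Binary.Construct.Closure.ReflexiveTransitive using (Star)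
open import Function.Bundles using (_⇔_)

module _ {n : ℕ} (_≤_ : Fin n → Fin n → Set) where

  _<_ : Fin n → Fin n → Set
  x < y = x ≤ y × x ≢ y

  _⋖_ : Fin n → Fin n → Set
  x ⋖ y = x < y × (∀ z → x < z → z < y → ⊥)

  Minimal : Fin n → Set
  Minimal m = ∀ y → y ≤ m → y ≡ m

  UniqueMinimal : Fin n → Set
  UniqueMinimal b = Minimal b × (∀ m → Minimal m → m ≡ b)

  IsRankFunction : Fin n → (Fin n → ℕ) → Set
  IsRankFunction b rk = rk b ≡ 0 × (∀ x y → x ⋖ y → rk y ≡ suc (rk x))

  interval : Decidable _≤_ → Fin n → Fin n → List (Fin n)
  interval _≤?_ x y = filter (λ z → (x ≤? z) ×-dec (z ≤? y)) (allFin n)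

  Thin : Decidable _≤_ → (Fin n → ℕ) → Set
  Thin _≤?_ rk = ∀ x y → x ≤ y → rk y ≡ 2 + rk x → length (interval _≤?_ x y) ≡ 4

  Diamond : Fin n → Fin n → Fin n → Fin n → Set
  Diamond x a b y = x ⋖ a × a ⋖ y × x ⋖ b × b ⋖ y × a ≢ b

  data SatChain : Fin n → Fin n → List (Fin n) → Set where
    single : ∀ x → SatChain x x (x ∷ [])
    step   : ∀ {x y z l} → x ⋖ y → SatChain y z l → SatChain x z (x ∷ l)

  -- a diamond move: replace a subchain x ⋖ a ⋖ y by x ⋖ b ⋖ y
  -- (Diamond is symmetric in a and b, so this covers "vice versa")
  DiamondMove : List (Fin n) → List (Fin n) → Set
  DiamondMove l l′ = Σ (List (Fin n)) λ l₁ → Σ (List (Fin n)) λ l₂ →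
    Σ (Fin n) λ x → Σ (Fin n) λ a → Σ (Fin n) λ b → Σ (Fin n) λ y →
      Diamond x a b y × l ≡ l₁ ++ (x ∷ a ∷ y ∷ l₂) × l′ ≡ l₁ ++ (x ∷ b ∷ y ∷ l₂)

  DiamondTransitive : Set
  DiamondTransitive = ∀ x y l l′ → x ≤ y → SatChain x y l → SatChain x y l′ →
    Star DiamondMove l l′

  -- a central coloring: c x y is the color of the cover x ⋖ y
  -- (values of c on non-covers are irrelevant); Sign.+ = 1, Sign.- = -1
  CentralColoring : (Fin n → Fin n → Sign) → Set
  CentralColoring c = ∀ x a b y → Diamond x a b y →
    ((c x a *ˢ c a y) *ˢ c x b) *ˢ c b y ≡ Sign.+

  -- a choice 𝒪 of a linear ordering of every rank, given as a
  -- duplicate-free enumeration 𝒪 i of the elements of rank i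
  IsRankOrdering : (Fin n → ℕ) → (ℕ → List (Fin n)) → Set
  IsRankOrdering rk 𝒪 = ∀ i → Unique (𝒪 i) × (∀ u → (u ∈ 𝒪 i) ⇔ (rk u ≡ i))

  AssignedBefore : (Fin n → ℕ) → (ℕ → List (Fin n)) → Fin n → Fin n → Set
  AssignedBefore rk 𝒪 z u = rk z <ℕ rk u ⊎
    (rk z ≡ rk u × Σ (List (Fin n)) λ l₁ → Σ (List (Fin n)) λ l₂ →
       𝒪 (rk u) ≡ l₁ ++ (u ∷ l₂) × z ∈ l₁)

  -- g is the output of the greedy procedure gr^c_𝒪: rank-0 elements get 1,
  -- and a later element u gets 1 iff, assigning 1 to u, g(z) g(u) = c(z ⋖ u)
  -- for every already-assigned z ⋖ u; otherwise it gets -1.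
  IsGreedy : (Fin n → ℕ) → (Fin n → Fin n → Sign) → (ℕ → List (Fin n)) →
             (Fin n → Sign) → Set
  IsGreedy rk c 𝒪 g = ∀ u →
    (rk u ≡ 0 → g u ≡ Sign.+) ×
    (rk u ≢ 0 → (g u ≡ Sign.+ ⇔
      (∀ z → AssignedBefore rk 𝒪 z u → z ⋖ u → g z *ˢ Sign.+ ≡ c z u)))

module Submission where

--  * Existence: f itself passes the greedy test.  At an element u of
--    positive rank, if f(u) = 1 then every cover equation into u reads
--    f(z) · 1 = c(z ⋖ u); if f(u) = -1 then u, not being 0̂, has a lower
--    cover z, which has smaller rank and hence is assigned before u, and its
--    cover equation makes the test fail.
--
--  * Uniqueness: the greedy test at u only inspects values strictly below u,
--    so by well-founded induction on the finite poset any two functions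
--    satisfying the greedy specification agree everywhere.

open import Defs
open import Data.Nat using (ℕ) renaming (_<_ to _<ℕ_)
open import Data.Nat.Properties using (n<1+n) renaming (_≟_ to _≟ℕ_)
open import Data.Fin using (Fin)
open import Data.Fin.Properties using (any?) renaming (_≟_ to _≟F_)
open import Data.Fin.Induction using (po-wellFounded; po-noetherian)
open import Data.List using (List)
open import Data.Product using (_×_; _,_; proj₁; proj₂; ∃)
open import Data.Sum using (_⊎_; inj₁; inj₂)
open import Data.Sign using (Sign) renaming (_*_ to _*ˢ_)
open import Data.Sign.Properties using (*-cancelˡ-≡)
open import Relation.Nullary using (¬_; yes; no; contradiction)
open import Relation.Nullary.Decidable using (_×-dec_; ¬?)
open import Relation.Binary.Definitions using (Decidable)
open import Relation.Binary.Structures using (IsPartialOrder)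
open import Relation.Binary.PropositionalEquality
  using (_≡_; refl; sym; trans; subst)
open import Induction.WellFounded using (Acc; acc)
open import Function.Bundles using (_⇔_; mk⇔; Equivalence)

sign-ext : ∀ s t → (s ≡ Sign.+ → t ≡ Sign.+) → (t ≡ Sign.+ → s ≡ Sign.+) → s ≡ t
sign-ext Sign.- Sign.- _ _ = refl
sign-ext Sign.- Sign.+ _ t⇒s = t⇒s refl
sign-ext Sign.+ Sign.- s⇒t _ = sym (s⇒t refl)
sign-ext Sign.+ Sign.+ _ _ = refl

module LowerCovers {n : ℕ} {_≤_ : Fin n → Fin n → Set}
  (isPO : IsPartialOrder _≡_ _≤_) (_≤?_ : Decidable _≤_) where

  _<?_ : Decidable (_<_ _≤_)
  x <? y = (x ≤? y) ×-dec ¬? (x ≟F y)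

  -- An element with something strictly below it has a lower cover: walk up
  -- from y towards u; the walk stops since the poset is finite (noetherian).
  cover-below : ∀ u y → Acc (λ a b → _<_ _≤_ b a) y → _<_ _≤_ y u →
                ∃ λ z → _⋖_ _≤_ z u
  cover-below u y (acc rec) y<u with any? (λ w → (y <? w) ×-dec (w <? u))
  ... | yes (w , y<w , w<u) = cover-below u w (rec y<w) w<u
  ... | no ¬between = y , y<u , λ w y<w w<u → ¬between (w , y<w , w<u)

  minimal-or-above : ∀ u → Minimal _≤_ u ⊎ ∃ λ y → _<_ _≤_ y u
  minimal-or-above u with any? (λ y → y <? u)
  ... | yes below = inj₂ below
  ... | no ¬below = inj₁ λ y y≤u → below-equal y y≤u
    where
    below-equal : ∀ y → y ≤ u → y ≡ u
    below-equal y y≤u with y ≟F u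
    ... | yes y≡u = y≡u
    ... | no y≢u = contradiction (y , y≤u , y≢u) ¬below

  zero-or-covered : ∀ 0̂ → UniqueMinimal _≤_ 0̂ → ∀ u → u ≡ 0̂ ⊎ ∃ λ z → _⋖_ _≤_ z u
  zero-or-covered 0̂ (_ , only-minimal) u with minimal-or-above u
  ... | inj₁ minimal = inj₁ (only-minimal u minimal)
  ... | inj₂ (y , y<u) = inj₂ (cover-below u y (po-noetherian isPO y) y<u)

module Greedy {n : ℕ} (_≤_ : Fin n → Fin n → Set) (rk : Fin n → ℕ)
  (c : Fin n → Fin n → Sign) (𝒪 : ℕ → List (Fin n)) where

  GreedyTest : (Fin n → Sign) → Fin n → Set
  GreedyTest g u = ∀ z → AssignedBefore _≤_ rk 𝒪 z u → _⋖_ _≤_ z u →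
                   g z *ˢ Sign.+ ≡ c z u

  test-transport : ∀ g h u → (∀ z → _<_ _≤_ z u → g z ≡ h z) →
                   GreedyTest g u → GreedyTest h u
  test-transport g h u g≡h test z before z⋖u =
    subst (λ s → s *ˢ Sign.+ ≡ c z u) (g≡h z (proj₁ z⋖u)) (test z before z⋖u)

  greedy-unique : IsPartialOrder _≡_ _≤_ → ∀ g h →
                  IsGreedy _≤_ rk c 𝒪 g → IsGreedy _≤_ rk c 𝒪 h → ∀ x → g x ≡ h x
  greedy-unique isPO g h greedy-g greedy-h x = go x (po-wellFounded isPO x)
    where
    go : ∀ x → Acc (_<_ _≤_) x → g x ≡ h x
    go x (acc rec) with rk x ≟ℕ 0
    ... | yes rk≡0 = trans (proj₁ (greedy-g x) rk≡0) (sym (proj₁ (greedy-h x) rk≡0))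
    ... | no rk≢0 = sign-ext (g x) (h x)
      (λ g+ → Equivalence.from (proj₂ (greedy-h x) rk≢0)
                (test-transport g h x below (Equivalence.to (proj₂ (greedy-g x) rk≢0) g+)))
      (λ h+ → Equivalence.from (proj₂ (greedy-g x) rk≢0)
                (test-transport h g x (λ z z<x → sym (below z z<x))
                  (Equivalence.to (proj₂ (greedy-h x) rk≢0) h+)))
      where
      below : ∀ z → _<_ _≤_ z x → g z ≡ h z
      below z z<x = go z (rec z<x)

  -- A lower cover has smaller rank, so it is assigned first.
  cover-assigned-before : ∀ {0̂} → IsRankFunction _≤_ 0̂ rk → ∀ z u → _⋖_ _≤_ z u →
                          AssignedBefore _≤_ rk 𝒪 z u
  cover-assigned-before (_ , rk-cover) z u z⋖u =
    inj₁ (subst (rk z <ℕ_) (sym (rk-cover z u z⋖u)) (n<1+n (rk z)))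

  -- A solution f of the cover equations passes the greedy test at u exactly
  -- when f(u) = +, provided u has a lower cover z: if the test passes, the
  -- equation along z ⋖ u gives f(z) · + = f(z) · f(u), so f(u) = +.
  solution-test : ∀ {0̂} → IsRankFunction _≤_ 0̂ rk →
                  ∀ f → (∀ x y → _⋖_ _≤_ x y → f x *ˢ f y ≡ c x y) →
                  ∀ z u → _⋖_ _≤_ z u → f u ≡ Sign.+ ⇔ GreedyTest f u
  solution-test isRank f cover-eq z u z⋖u = mk⇔ passes forces+
    where
    passes : f u ≡ Sign.+ → GreedyTest f u
    passes f+ y _ y⋖u = subst (λ s → f y *ˢ s ≡ c y u) f+ (cover-eq y u y⋖u)

    forces+ : GreedyTest f u → f u ≡ Sign.+
    forces+ test = sym (*-cancelˡ-≡ (f z) Sign.+ (f u)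
      (trans (test z (cover-assigned-before isRank z u z⋖u) z⋖u) (sym (cover-eq z u z⋖u))))

  -- In a finite decidable poset graded from its unique minimum 0̂, a solution
  -- of the cover equations with f(0̂) = + satisfies the greedy specification:
  -- rank 0 is {0̂}, and every element of positive rank has a lower cover.
  solution-is-greedy : IsPartialOrder _≡_ _≤_ → Decidable _≤_ →
                       ∀ 0̂ → UniqueMinimal _≤_ 0̂ → IsRankFunction _≤_ 0̂ rk →
                       ∀ f → f 0̂ ≡ Sign.+ →
                       (∀ x y → _⋖_ _≤_ x y → f x *ˢ f y ≡ c x y) →
                       IsGreedy _≤_ rk c 𝒪 f
  solution-is-greedy isPO _≤?_ 0̂ uniqueMin isRank@(rk0̂≡0 , rk-cover) f f0̂ cover-eq u =
    rank-zero , positive-rank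
    where
    open LowerCovers isPO _≤?_ using (zero-or-covered)

    rank-zero : rk u ≡ 0 → f u ≡ Sign.+
    rank-zero rk≡0 with zero-or-covered 0̂ uniqueMin u
    ... | inj₁ refl = f0̂
    ... | inj₂ (z , z⋖u) with trans (sym rk≡0) (rk-cover z u z⋖u)
    ...   | ()

    positive-rank : ¬ rk u ≡ 0 → f u ≡ Sign.+ ⇔ GreedyTest f u
    positive-rank rk≢0 with zero-or-covered 0̂ uniqueMin u
    ... | inj₁ refl = contradiction rk0̂≡0 rk≢0
    ... | inj₂ (z , z⋖u) = solution-test isRank f cover-eq z u z⋖u

mainTheorem10 : (n : ℕ) (_≤_ : Fin n → Fin n → Set) →
    IsPartialOrder _≡_ _≤_ → (_≤?_ : Decidable _≤_) →
    (0̂ : Fin n) → UniqueMinimal _≤_ 0̂ →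
    (rk : Fin n → ℕ) → IsRankFunction _≤_ 0̂ rk →
    Thin _≤_ _≤?_ rk → DiamondTransitive _≤_ →
    (c : Fin n → Fin n → Sign) → CentralColoring _≤_ c →
    (f : Fin n → Sign) → f 0̂ ≡ Sign.+ →
    (∀ x y → _⋖_ _≤_ x y → f x *ˢ f y ≡ c x y) →
    (𝒪 : ℕ → List (Fin n)) → IsRankOrdering _≤_ rk 𝒪 →
    IsGreedy _≤_ rk c 𝒪 f ×
    (∀ g → IsGreedy _≤_ rk c 𝒪 g → ∀ x → f x ≡ g x)
mainTheorem10 n _≤_ isPO _≤?_ 0̂ uniqueMin rk isRank _ _ c _ f f0̂ cover-eq 𝒪 _ =
  f-greedy , λ g g-greedy → greedy-unique isPO f g f-greedy g-greedy
  where
  open Greedy _≤_ rk c 𝒪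
  f-greedy : IsGreedy _≤_ rk c 𝒪 f
  f-greedy = solution-is-greedy isPO _≤?_ 0̂ uniqueMin isRank f f0̂ cover-eq
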